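{- Let $T\in\binom{[n]}{k}$ and let $M=\langle T\rangle$ be the corresponding rank $k$ shifted matroid, and let $\ell>1$. Then $M$ is $\ell$-uniform assumable if and only if for any $D_1,\dots,D_\ell\in\binom{[n]}{k}\setminus M$, \[D_1+\dots+D_\ell\nprec T+\dots+T,\] where the right-hand side is the sorted concatenation of $\ell$ copies of $T$.
   Context: $W(k,n)$ is the set of weakly increasing words of length $k$ over $[n]$; $k$-subsets of $[n]$ are identified with strictly increasing words. The component-wise order: $S\prec T$ iff $S(i)\le T(i)$ for all $i$. For $T\in\binom{[n]}{k}$, $\langle T\rangle$ is the matroid on $[n]$ (identified with its set of bases) with bases $\{S\in\binom{[n]}{k}:S\prec T\}$. The sorted concatenation $A+B$ of words $A\in W(k,n)$, $B\in W(k',n)$ is the word in $W(k+k',n)$ in which each $i$ occurs as often as in $A$ and $B$ combined. $M$ is $\ell$-uniform assumable if for all bases $B_1,\dots,B_\ell\in M$ and all $D_1,\dots,D_\ell\in\binom{[n]}{k}\setminus M$, $B_1+\dots+B_\ell\neq D_1+\dots+D_\ell$. -}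

module Defs where

open import Data.Nat using (ℕ; suc)
open import Data.Fin using (Fin) renaming (_≤_ to _≤ᶠ_; _<_ to _<ᶠ_)
open import Data.Fin.Properties using (_≟_)
open import Data.Vec using (Vec; lookup; count)
open import Data.List as List using (List; concatMap; replicate; allFin; tabulate)
open import Data.Product using (_×_)
open import Relation.Nullary using (¬_)
import Data.List.Relation.Binary.Pointwise as LPw
import Data.Vec.Relation.Binary.Pointwise.Inductive as VPw
import Data.Fin
open import Data.Nat.ListAction using (sum)

-- [n] is modelled as Fin n (elements 0,…,n-1, in their usual order).
-- A word of length k over [n]: Vec (Fin n) k.

-- k-subsets of [n] are identified with strictly increasing words.
StrictlyIncreasing : ∀ {n k} → Vec (Fin n) k → Set
StrictlyIncreasing {n} {k} w = ∀ (i j : Fin k) → i <ᶠ j → lookup w i <ᶠ lookup w j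

_≺_ : ∀ {n k} → Vec (Fin n) k → Vec (Fin n) k → Set
S ≺ T = VPw.Pointwise _≤ᶠ_ S T

_≺ˡ_ : ∀ {n} → List (Fin n) → List (Fin n) → Set
A ≺ˡ B = LPw.Pointwise _≤ᶠ_ A B

-- The shifted matroid ⟨T⟩, as its set of bases: k-subsets S with S ≺ T.
⟨_⟩ : ∀ {n k} → Vec (Fin n) k → Vec (Fin n) k → Set
⟨ T ⟩ S = StrictlyIncreasing S × (S ≺ T)

occ : ∀ {n k} → Fin n → Vec (Fin n) k → ℕ
occ x w = count (_≟ x) w

-- Sorted concatenation W 0 + W 1 + … + W (ℓ-1): the weakly increasing word
-- in which each x occurs as often as in all W i combined.
sortedSum : ∀ {n k ℓ} → (Fin ℓ → Vec (Fin n) k) → List (Fin n)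
sortedSum {n} {k} {ℓ} W =
  concatMap (λ x → replicate (sum (tabulate (λ i → occ x (W i)))) x) (allFin n)

UniformAssumable : ∀ {n k} → ℕ → (Vec (Fin n) k → Set) → Set
UniformAssumable {n} {k} ℓ M =
  ∀ (B D : Fin ℓ → Vec (Fin n) k) →
  (∀ i → M (B i)) →
  (∀ i → StrictlyIncreasing (D i) × ¬ M (D i)) →
  ¬ (sortedSum B ≡ sortedSum D)
  where open import Relation.Binary.PropositionalEquality using (_≡_)

{-# OPTIONS --safe #-}
-- A multiset c on [n] is encoded by its multiplicities, and its sorted word has an entry
-- ≤ x at position p exactly when p < atMost c x, the number of elements of c that are ≤ x.
-- So for sorted words of the same length the componentwise order is the reverse order of
-- these cumulative counts, which add up under sorted concatenation.
-- (⇐) Bases B i ≺ T therefore give B 0 + … + B (ℓ-1) ≺ T + … + T.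
-- (⇒) If W = D 0 + … + D (ℓ-1) ≺ T + … + T, read W in columns: B i is made of the entries at
-- positions i, ℓ + i, 2ℓ + i, … . No letter occurs more than ℓ times in W, since each D i is
-- a set, so every B i is strictly increasing. The entry at position mℓ + i is at most the
-- entry of T + … + T there, which is T m, so B i ≺ T. Together the columns use every entry
-- of W exactly once, so B 0 + … + B (ℓ-1) = W.
module Submission where

open import Defs
open import Data.Nat using (ℕ; zero; suc; _+_; _*_; _≤_; _<_; _≤?_; z≤n; s≤s; s≤s⁻¹; z<s; s<s)
open import Data.Nat.Properties hiding (_≟_)
open import Data.Nat.ListAction using () renaming (sum to sumˡ)
import Data.Fin as Fin
open import Data.Fin using (Fin; zero; suc; toℕ) renaming (_≤_ to _≤ᶠ_; _<_ to _<ᶠ_)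
open import Data.Fin.Properties using (_≟_; toℕ<n; toℕ-injective) renaming (0≢1+n to zero≢suc)
open import Data.Vec using (Vec; []; _∷_; lookup; fromList)
open import Data.List as List
  using (List; []; _∷_; _++_; replicate; map; length; concatMap; allFin; applyUpTo)
open import Data.List.Properties
  using ( length-++; length-replicate; length-map; map-tabulate; map-replicate
        ; concatMap-cong; concatMap-map; map-concatMap)
open import Data.List.Relation.Binary.Pointwise using (Pointwise; []; _∷_)
open import Data.List.Relation.Binary.Pointwise.Properties using (Pointwise-length)
open import Data.Vec.Relation.Binary.Pointwise.Inductive using ([]; _∷_)
import Data.Vec.Relation.Binary.Pointwise.Extensional as Ext
open import Algebra.Properties.CommutativeMonoid.Sum +-0-commutativeMonoid
  using (sum-syntax; sum-cong-≗; sum-replicate-zero; ∑-distrib-+; ∑-comm)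
open import Algebra.Properties.CommutativeSemigroup +-commutativeSemigroup using (interchange; xy∙z≈zx∙y)
open import Data.Bool using (true; false; if_then_else_)
open import Data.Product using (Σ-syntax; _×_; _,_; proj₁; proj₂)
open import Function using (_∘_; _⇔_; mk⇔; Equivalence)
open import Relation.Nullary using (¬_; does; yes; no; contradiction)
open import Relation.Binary.PropositionalEquality

∑-mono-≤ : ∀ {ℓ} {g h : Fin ℓ → ℕ} → (∀ i → g i ≤ h i) → ∑[ i < ℓ ] g i ≤ ∑[ i < ℓ ] h i
∑-mono-≤ {zero}  _   = z≤n
∑-mono-≤ {suc ℓ} g≤h = +-mono-≤ (g≤h zero) (∑-mono-≤ (g≤h ∘ suc))

∑-const : ∀ ℓ a → ∑[ i < ℓ ] a ≡ ℓ * a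
∑-const zero    a = refl
∑-const (suc ℓ) a = cong (a +_) (∑-const ℓ a)

sumˡ-tabulate : ∀ {ℓ} (g : Fin ℓ → ℕ) → sumˡ (List.tabulate g) ≡ ∑[ i < ℓ ] g i
sumˡ-tabulate {zero}  g = refl
sumˡ-tabulate {suc ℓ} g = cong (g zero +_) (sumˡ-tabulate (g ∘ suc))

-- Multisets on Fin n, as multiplicity functions

size : ∀ {n} → (Fin n → ℕ) → ℕ
size {n} c = ∑[ y < n ] c y

sorted : ∀ {n} → (Fin n → ℕ) → List (Fin n)
sorted {zero}  c = []
sorted {suc n} c = replicate (c zero) zero ++ map suc (sorted (c ∘ suc))

atMost : ∀ {n} → (Fin n → ℕ) → Fin n → ℕ
atMost c zero    = c zero
atMost c (suc x) = c zero + atMost (c ∘ suc) x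

below : ∀ {n} → (Fin n → ℕ) → Fin n → ℕ
below c zero    = 0
below c (suc x) = c zero + below (c ∘ suc) x

concatMap-replicate : ∀ {n} (c : Fin n → ℕ) → concatMap (λ x → replicate (c x) x) (allFin n) ≡ sorted c
concatMap-replicate {zero}  c = refl
concatMap-replicate {suc n} c = cong (replicate (c zero) zero ++_) (begin
  concatMap (λ x → replicate (c x) x) (List.tabulate Fin.suc)
    ≡⟨ cong (concatMap (λ x → replicate (c x) x)) (map-tabulate (λ x → x) Fin.suc) ⟨
  concatMap (λ x → replicate (c x) x) (map Fin.suc (allFin n))
    ≡⟨ concatMap-map _ Fin.suc (allFin n) ⟩
  concatMap (λ x → replicate (c (suc x)) (suc x)) (allFin n)
    ≡⟨ concatMap-cong (λ x → map-replicate Fin.suc (c (suc x)) x) (allFin n) ⟨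
  concatMap (λ x → map Fin.suc (replicate (c (suc x)) x)) (allFin n)
    ≡⟨ map-concatMap Fin.suc _ (allFin n) ⟨
  map Fin.suc (concatMap (λ x → replicate (c (suc x)) x) (allFin n))
    ≡⟨ cong (map Fin.suc) (concatMap-replicate (c ∘ suc)) ⟩
  map Fin.suc (sorted (c ∘ suc)) ∎)
  where open ≡-Reasoning

length-sorted : ∀ {n} (c : Fin n → ℕ) → length (sorted c) ≡ size c
length-sorted {zero}  c = refl
length-sorted {suc n} c =
  trans (length-++ (replicate (c zero) zero))
        (cong₂ _+_ (length-replicate (c zero))
                   (trans (length-map Fin.suc (sorted (c ∘ suc))) (length-sorted (c ∘ suc))))

atMost-cong : ∀ {n} {c d : Fin n → ℕ} → (∀ y → c y ≡ d y) → ∀ x → atMost c x ≡ atMost d x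
atMost-cong c≗d zero    = c≗d zero
atMost-cong c≗d (suc x) = cong₂ _+_ (c≗d zero) (atMost-cong (c≗d ∘ suc) x)

atMost-0 : ∀ {n} (x : Fin n) → atMost (λ _ → 0) x ≡ 0
atMost-0 zero    = refl
atMost-0 (suc x) = atMost-0 x

atMost-+ : ∀ {n} (c d : Fin n → ℕ) x → atMost (λ y → c y + d y) x ≡ atMost c x + atMost d x
atMost-+ c d zero    = refl
atMost-+ c d (suc x) =
  trans (cong (c zero + d zero +_) (atMost-+ (c ∘ suc) (d ∘ suc) x)) (interchange (c zero) (d zero) _ _)

atMost-∑ : ∀ {n ℓ} (c : Fin ℓ → Fin n → ℕ) x →
  atMost (λ y → ∑[ i < ℓ ] c i y) x ≡ ∑[ i < ℓ ] atMost (c i) x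
atMost-∑ {ℓ = zero}  c x = atMost-0 x
atMost-∑ {ℓ = suc ℓ} c x =
  trans (atMost-+ (c zero) _ x) (cong (atMost (c zero) x +_) (atMost-∑ (c ∘ suc) x))

atMost≤size : ∀ {n} (c : Fin n → ℕ) x → atMost c x ≤ size c
atMost≤size c zero    = m≤m+n (c zero) _
atMost≤size c (suc x) = +-monoʳ-≤ (c zero) (atMost≤size (c ∘ suc) x)

atMost≡below+ : ∀ {n} (c : Fin n → ℕ) x → atMost c x ≡ below c x + c x
atMost≡below+ c zero    = refl
atMost≡below+ c (suc x) = trans (cong (c zero +_) (atMost≡below+ (c ∘ suc) x)) (sym (+-assoc (c zero) _ _))

below≤atMost : ∀ {n} (c : Fin n → ℕ) x → below c x ≤ atMost c x
below≤atMost c x = ≤-trans (m≤m+n (below c x) (c x)) (≤-reflexive (sym (atMost≡below+ c x)))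

multiplicity-zero≤atMost : ∀ {n} (c : Fin (suc n) → ℕ) x → c zero ≤ atMost c x
multiplicity-zero≤atMost c zero    = ≤-refl
multiplicity-zero≤atMost c (suc x) = m≤m+n (c zero) _

-- Positions in sorted lists

nth : ∀ {A : Set} → List A → ℕ → A → A
nth []       p       d = d
nth (a ∷ xs) zero    d = a
nth (a ∷ xs) (suc p) d = nth xs p d

nth-replicate-++ˡ : ∀ {A : Set} {a p} (z : A) xs d → p < a → nth (replicate a z ++ xs) p d ≡ z
nth-replicate-++ˡ {a = suc a} {zero}  z xs d _         = refl
nth-replicate-++ˡ {a = suc a} {suc p} z xs d (s<s p<a) = nth-replicate-++ˡ z xs d p<a

nth-replicate-++ʳ : ∀ {A : Set} a (z : A) xs q d → nth (replicate a z ++ xs) (a + q) d ≡ nth xs q d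
nth-replicate-++ʳ zero    z xs q d = refl
nth-replicate-++ʳ (suc a) z xs q d = nth-replicate-++ʳ a z xs q d

nth-map : ∀ {A B : Set} (f : A → B) xs {p} d d' → p < length xs → nth (map f xs) p d ≡ f (nth xs p d')
nth-map f (_ ∷ _)  {zero}  d d' _         = refl
nth-map f (_ ∷ xs) {suc p} d d' (s<s p<n) = nth-map f xs d d' p<n

nth-map-suc≢zero : ∀ {n} (xs : List (Fin n)) {p} d → p < length xs → nth (map Fin.suc xs) p d ≢ zero
nth-map-suc≢zero xs@(a ∷ _) d p<n eq = zero≢suc (trans (sym eq) (nth-map Fin.suc xs d a p<n))

data Offset (a : ℕ) : ℕ → Set where
  inside  : ∀ {p} → p < a → Offset a p
  outside : ∀ q → Offset a (a + q)

offset : ∀ a p → Offset a p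
offset zero    p       = outside p
offset (suc a) zero    = inside z<s
offset (suc a) (suc p) with offset a p
... | inside p<a = inside (s<s p<a)
... | outside q  = outside q

nth-sorted-head : ∀ {n} (c : Fin (suc n) → ℕ) {p} d → p < c zero → nth (sorted c) p d ≡ zero
nth-sorted-head c d = nth-replicate-++ˡ zero _ d

nth-sorted-tail : ∀ {n} (c : Fin (suc n) → ℕ) {q} d d' → q < size (c ∘ suc) →
  nth (sorted c) (c zero + q) d ≡ suc (nth (sorted (c ∘ suc)) q d')
nth-sorted-tail c {q} d d' q<size =
  trans (nth-replicate-++ʳ (c zero) zero _ q d)
        (nth-map Fin.suc (sorted (c ∘ suc)) d d' (subst (q <_) (sym (length-sorted (c ∘ suc))) q<size))

nth-sorted-tail≢zero : ∀ {n} (c : Fin (suc n) → ℕ) {q} d → q < size (c ∘ suc) →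
  nth (sorted c) (c zero + q) d ≢ zero
nth-sorted-tail≢zero c {q} d q<size =
  subst (_≢ zero) (sym (nth-replicate-++ʳ (c zero) zero _ q d))
        (nth-map-suc≢zero (sorted (c ∘ suc)) d (subst (q <_) (sym (length-sorted (c ∘ suc))) q<size))

nth-sorted-≤ : ∀ {n} (c : Fin n → ℕ) {p} x d → p < atMost c x → nth (sorted c) p d ≤ᶠ x
nth-sorted-≤ c zero d p<c₀ = ≤-reflexive (cong toℕ (nth-sorted-head c d p<c₀))
nth-sorted-≤ c {p} (suc x) d p<atMost with offset (c zero) p
... | inside p<c₀ = subst (_≤ᶠ suc x) (sym (nth-sorted-head c d p<c₀)) z≤n
... | outside q   =
  subst (_≤ᶠ suc x) (sym (nth-sorted-tail c d x q<size)) (s≤s (nth-sorted-≤ (c ∘ suc) x x q<atMost))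
  where
  q<atMost : q < atMost (c ∘ suc) x
  q<atMost = +-cancelˡ-< (c zero) q _ p<atMost
  q<size : q < size (c ∘ suc)
  q<size = <-≤-trans q<atMost (atMost≤size (c ∘ suc) x)

nth-sorted-≤⁻ : ∀ {n} (c : Fin n → ℕ) {p} x d → p < size c → nth (sorted c) p d ≤ᶠ x → p < atMost c x
nth-sorted-≤⁻ {suc n} c {p} x d p<size ≤x with offset (c zero) p
... | inside p<c₀ = <-≤-trans p<c₀ (multiplicity-zero≤atMost c x)
nth-sorted-≤⁻ {suc n} c zero d p<size ≤x | outside q =
  contradiction (toℕ-injective (n≤0⇒n≡0 ≤x)) (nth-sorted-tail≢zero c d (+-cancelˡ-< (c zero) q _ p<size))
nth-sorted-≤⁻ {suc n} c (suc x) d p<size ≤x | outside q =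
  +-monoʳ-< (c zero)
    (nth-sorted-≤⁻ (c ∘ suc) x x q<size (s≤s⁻¹ (subst (_≤ᶠ suc x) (nth-sorted-tail c d x q<size) ≤x)))
  where
  q<size : q < size (c ∘ suc)
  q<size = +-cancelˡ-< (c zero) q _ p<size

nth-sorted-< : ∀ {n} (c : Fin n → ℕ) {p} x d → p < below c x → nth (sorted c) p d <ᶠ x
nth-sorted-< c {p} (suc x) d p<below with offset (c zero) p
... | inside p<c₀ = subst (_<ᶠ suc x) (sym (nth-sorted-head c d p<c₀)) z<s
... | outside q   =
  subst (_<ᶠ suc x) (sym (nth-sorted-tail c d x q<size)) (s<s (nth-sorted-< (c ∘ suc) x x q<below))
  where
  q<below : q < below (c ∘ suc) x
  q<below = +-cancelˡ-< (c zero) q _ p<below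
  q<size : q < size (c ∘ suc)
  q<size = <-≤-trans q<below (≤-trans (below≤atMost (c ∘ suc) x) (atMost≤size (c ∘ suc) x))

Pointwise-nth : ∀ {A : Set} {R : A → A → Set} {xs ys} → Pointwise R xs ys →
  ∀ {p} d d' → p < length xs → R (nth xs p d) (nth ys p d')
Pointwise-nth (r ∷ rs) {zero}  d d' _         = r
Pointwise-nth (r ∷ rs) {suc p} d d' (s<s p<n) = Pointwise-nth rs d d' p<n

nth-Pointwise : ∀ {A : Set} {R : A → A → Set} (xs ys : List A) → length xs ≡ length ys →
  (∀ {p} d → p < length xs → R (nth xs p d) (nth ys p d)) → Pointwise R xs ys
nth-Pointwise []       []       _   _ = []
nth-Pointwise (x ∷ xs) (y ∷ ys) len R-nth =
  R-nth x z<s ∷ nth-Pointwise xs ys (suc-injective len) (λ d p<n → R-nth d (s<s p<n))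

sorted-≺ˡ⇔ : ∀ {n} (c d : Fin n → ℕ) →
  sorted c ≺ˡ sorted d ⇔ (size c ≡ size d × (∀ x → atMost d x ≤ atMost c x))
sorted-≺ˡ⇔ c d = mk⇔ (λ c≺d → size≡ c≺d , dominated c≺d) (λ (c≡d , d≤c) → pointwise c≡d d≤c)
  where
  size≡ : sorted c ≺ˡ sorted d → size c ≡ size d
  size≡ c≺d = trans (sym (length-sorted c)) (trans (Pointwise-length c≺d) (length-sorted d))

  dominated : sorted c ≺ˡ sorted d → ∀ x → atMost d x ≤ atMost c x
  dominated c≺d x = ≮⇒≥ λ r<atMost →
    let r = atMost c x
        r<size = subst (r <_) (sym (size≡ c≺d)) (<-≤-trans r<atMost (atMost≤size d x))
        r<length = subst (r <_) (sym (length-sorted c)) r<size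
    in <-irrefl refl
         (nth-sorted-≤⁻ c x x r<size (≤-trans (Pointwise-nth c≺d x x r<length) (nth-sorted-≤ d x x r<atMost)))

  pointwise : size c ≡ size d → (∀ x → atMost d x ≤ atMost c x) → sorted c ≺ˡ sorted d
  pointwise c≡d d≤c = nth-Pointwise (sorted c) (sorted d)
    (trans (length-sorted c) (trans c≡d (sym (length-sorted d))))
    λ {p} e p<length →
      let y = nth (sorted d) p e
          p<size = subst (p <_) (trans (length-sorted c) c≡d) p<length
      in nth-sorted-≤ c y e (<-≤-trans (nth-sorted-≤⁻ d y e p<size ≤-refl) (d≤c y))

-- The occurrences of x fill the positions from below c x to atMost c x,
-- so two positions ℓ apart cannot both hold x when c x ≤ ℓ.
nth-sorted-<-apart : ∀ {n ℓ} (c : Fin n → ℕ) → (∀ y → c y ≤ ℓ) → ∀ {p p'} d d' →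
  p + ℓ ≤ p' → p' < size c → nth (sorted c) p d <ᶠ nth (sorted c) p' d'
nth-sorted-<-apart {n} {ℓ} c c≤ℓ {p} {p'} d d' gap p'<size = ≰⇒> λ ≤x → <-irrefl refl (begin-strict
  p'              <⟨ nth-sorted-≤⁻ c x d' p'<size ≤x ⟩
  atMost c x      ≡⟨ atMost≡below+ c x ⟩
  below c x + c x ≤⟨ +-mono-≤ below≤p (c≤ℓ x) ⟩
  p + ℓ           ≤⟨ gap ⟩
  p'              ∎)
  where
  open ≤-Reasoning
  x : Fin n
  x = nth (sorted c) p d
  below≤p : below c x ≤ p
  below≤p = ≮⇒≥ λ p<below → <-irrefl refl (nth-sorted-< c x d p<below)

-- Letter counts of words

δ : ∀ {n} → Fin n → Fin n → ℕ
δ a x = if does (a ≟ x) then 1 else 0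

counts : ∀ {n k} → Vec (Fin n) k → Fin n → ℕ
counts v y = occ y v

occ-∷ : ∀ {n k} x a (v : Vec (Fin n) k) → occ x (a ∷ v) ≡ δ a x + occ x v
occ-∷ x a v with does (a ≟ x)
... | true  = refl
... | false = refl

occ≡0 : ∀ {n k} {x : Fin n} (v : Vec (Fin n) k) → (∀ i → x <ᶠ lookup v i) → occ x v ≡ 0
occ≡0 []      _   = refl
occ≡0 {x = x} (a ∷ v) x<v with a ≟ x
... | yes refl = contradiction (x<v zero) (<-irrefl refl)
... | no _     = occ≡0 v (x<v ∘ suc)

strictlyIncreasing-tail : ∀ {n k} {a : Fin n} {v : Vec (Fin n) k} →
  StrictlyIncreasing (a ∷ v) → StrictlyIncreasing v
strictlyIncreasing-tail si i j i<j = si (suc i) (suc j) (s<s i<j)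

occ≤1 : ∀ {n k} {x : Fin n} (v : Vec (Fin n) k) → StrictlyIncreasing v → occ x v ≤ 1
occ≤1 []      _  = z≤n
occ≤1 {x = x} (a ∷ v) si with a ≟ x
... | yes refl = s≤s (≤-reflexive (occ≡0 v (λ i → si zero (suc i) z<s)))
... | no _     = occ≤1 v (strictlyIncreasing-tail si)

size-δ : ∀ {n} (a : Fin n) → size (δ a) ≡ 1
size-δ {suc n} zero    = cong suc (sum-replicate-zero n)
size-δ {suc n} (suc a) = size-δ a

size-counts : ∀ {n k} (v : Vec (Fin n) k) → size (counts v) ≡ k
size-counts {n} []      = sum-replicate-zero n
size-counts     (a ∷ v) =
  trans (sum-cong-≗ (λ y → occ-∷ y a v))
        (trans (∑-distrib-+ (δ a) (counts v)) (cong₂ _+_ (size-δ a) (size-counts v)))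

atMost-δ-≥ : ∀ {n} {a x : Fin n} → a ≤ᶠ x → atMost (δ a) x ≡ 1
atMost-δ-≥ {a = zero}  {zero}  _         = refl
atMost-δ-≥ {a = zero}  {suc x} _         = cong suc (atMost-0 x)
atMost-δ-≥ {a = suc a} {suc x} (s≤s a≤x) = atMost-δ-≥ a≤x

atMost-δ-< : ∀ {n} {a x : Fin n} → x <ᶠ a → atMost (δ a) x ≡ 0
atMost-δ-< {a = suc a} {zero}  _         = refl
atMost-δ-< {a = suc a} {suc x} (s<s x<a) = atMost-δ-< x<a

atMost-δ-antitone : ∀ {n} {a b : Fin n} → b ≤ᶠ a → ∀ x → atMost (δ a) x ≤ atMost (δ b) x
atMost-δ-antitone {a = a} b≤a x with toℕ a ≤? toℕ x
... | yes a≤x = ≤-reflexive (trans (atMost-δ-≥ a≤x) (sym (atMost-δ-≥ (≤-trans b≤a a≤x))))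
... | no a≰x  = ≤-trans (≤-reflexive (atMost-δ-< (≰⇒> a≰x))) z≤n

atMost-counts-∷ : ∀ {n k} (a : Fin n) (v : Vec (Fin n) k) x →
  atMost (counts (a ∷ v)) x ≡ atMost (δ a) x + atMost (counts v) x
atMost-counts-∷ a v x = trans (atMost-cong (λ y → occ-∷ y a v) x) (atMost-+ (δ a) (counts v) x)

≺⇒atMost-counts-≥ : ∀ {n k} {B T : Vec (Fin n) k} → B ≺ T →
  ∀ x → atMost (counts T) x ≤ atMost (counts B) x
≺⇒atMost-counts-≥ []                                   x = ≤-refl
≺⇒atMost-counts-≥ (_∷_ {x = b} {t} {B} {T} b≤t B≺T) x = begin
  atMost (counts (t ∷ T)) x          ≡⟨ atMost-counts-∷ t T x ⟩
  atMost (δ t) x + atMost (counts T) x ≤⟨ +-mono-≤ (atMost-δ-antitone b≤t x) (≺⇒atMost-counts-≥ B≺T x) ⟩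
  atMost (δ b) x + atMost (counts B) x ≡⟨ atMost-counts-∷ b B x ⟨
  atMost (counts (b ∷ B)) x          ∎
  where open ≤-Reasoning

atMost-counts-lookup : ∀ {n k} (T : Vec (Fin n) k) → StrictlyIncreasing T →
  ∀ m → suc (toℕ m) ≤ atMost (counts T) (lookup T m)
atMost-counts-lookup (t ∷ T) si zero
  rewrite atMost-counts-∷ t T t | atMost-δ-≥ {a = t} ≤-refl = s≤s z≤n
atMost-counts-lookup (t ∷ T) si (suc m)
  rewrite atMost-counts-∷ t T (lookup T m) | atMost-δ-≥ (<⇒≤ (si zero (suc m) z<s)) =
  s≤s (atMost-counts-lookup T (strictlyIncreasing-tail si) m)

occ-fromList-++ : ∀ {n} x (xs ys : List (Fin n)) →
  occ x (fromList (xs ++ ys)) ≡ occ x (fromList xs) + occ x (fromList ys)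
occ-fromList-++ x []       ys = refl
occ-fromList-++ x (a ∷ xs) ys with does (a ≟ x)
... | true  = cong suc (occ-fromList-++ x xs ys)
... | false = occ-fromList-++ x xs ys

occ-fromList-replicate : ∀ {n} x a (y : Fin n) → occ x (fromList (replicate a y)) ≡ a * δ y x
occ-fromList-replicate x zero    y = refl
occ-fromList-replicate x (suc a) y =
  trans (occ-∷ x y (fromList (replicate a y))) (cong (δ y x +_) (occ-fromList-replicate x a y))

occ-zero-fromList-map-suc : ∀ {n} (xs : List (Fin n)) → occ zero (fromList (map Fin.suc xs)) ≡ 0
occ-zero-fromList-map-suc []       = refl
occ-zero-fromList-map-suc (_ ∷ xs) = occ-zero-fromList-map-suc xs

occ-suc-fromList-map-suc : ∀ {n} x (xs : List (Fin n)) →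
  occ (suc x) (fromList (map Fin.suc xs)) ≡ occ x (fromList xs)
occ-suc-fromList-map-suc x []       = refl
occ-suc-fromList-map-suc x (a ∷ xs) with does (a ≟ x)
... | true  = cong suc (occ-suc-fromList-map-suc x xs)
... | false = occ-suc-fromList-map-suc x xs

occ-fromList-sorted : ∀ {n} (c : Fin n → ℕ) x → occ x (fromList (sorted c)) ≡ c x
occ-fromList-sorted {suc n} c x =
  trans (occ-fromList-++ x (replicate (c zero) zero) (map Fin.suc tail)) (split x)
  where
  open ≡-Reasoning
  tail : List (Fin n)
  tail = sorted (c ∘ suc)
  split : ∀ x → occ x (fromList (replicate (c zero) zero)) + occ x (fromList (map Fin.suc tail)) ≡ c x
  split zero    = begin
    occ zero (fromList (replicate (c zero) zero)) + occ zero (fromList (map Fin.suc tail))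
      ≡⟨ cong₂ _+_ (occ-fromList-replicate zero (c zero) zero) (occ-zero-fromList-map-suc tail) ⟩
    c zero * 1 + 0 ≡⟨ +-identityʳ (c zero * 1) ⟩
    c zero * 1     ≡⟨ *-identityʳ (c zero) ⟩
    c zero         ∎
  split (suc x) = begin
    occ (suc x) (fromList (replicate (c zero) zero)) + occ (suc x) (fromList (map Fin.suc tail))
      ≡⟨ cong₂ _+_ (occ-fromList-replicate (suc x) (c zero) zero) (occ-suc-fromList-map-suc x tail) ⟩
    c zero * 0 + occ x (fromList tail) ≡⟨ cong (_+ occ x (fromList tail)) (*-zeroʳ (c zero)) ⟩
    occ x (fromList tail)              ≡⟨ occ-fromList-sorted (c ∘ suc) x ⟩
    c (suc x)                          ∎

-- Columns

applyUpTo-++ : ∀ {A : Set} (f : ℕ → A) a b →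
  applyUpTo f (a + b) ≡ applyUpTo f a ++ applyUpTo (λ p → f (a + p)) b
applyUpTo-++ f zero    b = refl
applyUpTo-++ f (suc a) b = cong (f 0 ∷_) (applyUpTo-++ (f ∘ suc) a b)

applyUpTo-nth : ∀ {A : Set} (xs : List A) d → applyUpTo (λ p → nth xs p d) (length xs) ≡ xs
applyUpTo-nth []       d = refl
applyUpTo-nth (x ∷ xs) d = cong (x ∷_) (applyUpTo-nth xs d)

occ-fromList-applyUpTo : ∀ {n} (f : ℕ → Fin n) N x →
  occ x (fromList (applyUpTo f N)) ≡ ∑[ p < N ] δ (f (toℕ p)) x
occ-fromList-applyUpTo f zero    x = refl
occ-fromList-applyUpTo f (suc N) x =
  trans (occ-∷ x (f 0) (fromList (applyUpTo (f ∘ suc) N)))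
        (cong (δ (f 0) x +_) (occ-fromList-applyUpTo (f ∘ suc) N x))

column : ∀ {A : Set} (k ℓ : ℕ) → (ℕ → A) → ℕ → Vec A k
column zero    ℓ f i = []
column (suc k) ℓ f i = f i ∷ column k ℓ (λ p → f (ℓ + p)) i

lookup-column : ∀ {A : Set} k ℓ (f : ℕ → A) i (m : Fin k) →
  lookup (column k ℓ f i) m ≡ f (toℕ m * ℓ + i)
lookup-column (suc k) ℓ f i zero    = refl
lookup-column (suc k) ℓ f i (suc m) =
  trans (lookup-column k ℓ (λ p → f (ℓ + p)) i m) (cong f (sym (+-assoc ℓ (toℕ m * ℓ) i)))

∑-occ-column : ∀ {n} k ℓ (f : ℕ → Fin n) x →
  ∑[ i < ℓ ] occ x (column k ℓ f (toℕ i)) ≡ occ x (fromList (applyUpTo f (k * ℓ)))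
∑-occ-column zero    ℓ f x = sum-replicate-zero ℓ
∑-occ-column {n} (suc k) ℓ f x = begin
  ∑[ i < ℓ ] occ x (column (suc k) ℓ f (toℕ i))
    ≡⟨ sum-cong-≗ {ℓ} (λ i → occ-∷ x (f (toℕ i)) (column k ℓ f′ (toℕ i))) ⟩
  ∑[ i < ℓ ] (δ (f (toℕ i)) x + occ x (column k ℓ f′ (toℕ i)))
    ≡⟨ ∑-distrib-+ {ℓ} (λ i → δ (f (toℕ i)) x) (λ i → occ x (column k ℓ f′ (toℕ i))) ⟩
  ∑[ i < ℓ ] δ (f (toℕ i)) x + ∑[ i < ℓ ] occ x (column k ℓ f′ (toℕ i))
    ≡⟨ cong₂ _+_ (sym (occ-fromList-applyUpTo f ℓ x)) (∑-occ-column k ℓ f′ x) ⟩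
  occ x (fromList (applyUpTo f ℓ)) + occ x (fromList (applyUpTo f′ (k * ℓ)))
    ≡⟨ occ-fromList-++ x (applyUpTo f ℓ) (applyUpTo f′ (k * ℓ)) ⟨
  occ x (fromList (applyUpTo f ℓ ++ applyUpTo f′ (k * ℓ)))
    ≡⟨ cong (occ x ∘ fromList) (applyUpTo-++ f ℓ (k * ℓ)) ⟨
  occ x (fromList (applyUpTo f (ℓ + k * ℓ))) ∎
  where
  open ≡-Reasoning
  f′ : ℕ → Fin n
  f′ p = f (ℓ + p)

column-strictlyIncreasing : ∀ {n} k ℓ (f : ℕ → Fin n) i →
  (∀ {m m'} → m < m' → m' < k → f (m * ℓ + i) <ᶠ f (m' * ℓ + i)) → StrictlyIncreasing (column k ℓ f i)
column-strictlyIncreasing k ℓ f i f-< m m' m<m' =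
  subst₂ _<ᶠ_ (sym (lookup-column k ℓ f i m)) (sym (lookup-column k ℓ f i m')) (f-< m<m' (toℕ<n m'))

column-≺ : ∀ {n k} ℓ (f : ℕ → Fin n) i (T : Vec (Fin n) k) →
  (∀ m → f (toℕ m * ℓ + i) ≤ᶠ lookup T m) → column k ℓ f i ≺ T
column-≺ {k = k} ℓ f i T f-≤ =
  Ext.extensional⇒inductive (Ext.ext λ m →
    subst (_≤ᶠ lookup T m) (sym (lookup-column k ℓ f i m)) (f-≤ m))

row-bound : ∀ {m k} ℓ {i} → m < k → i < ℓ → m * ℓ + i < k * ℓ
row-bound {m} {k} ℓ {i} m<k i<ℓ = begin-strict
  m * ℓ + i <⟨ +-monoʳ-< (m * ℓ) i<ℓ ⟩
  m * ℓ + ℓ ≡⟨ +-comm (m * ℓ) ℓ ⟩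
  suc m * ℓ ≤⟨ *-monoˡ-≤ ℓ m<k ⟩
  k * ℓ     ∎
  where open ≤-Reasoning

row-gap : ∀ {m m'} ℓ i → m < m' → m * ℓ + i + ℓ ≤ m' * ℓ + i
row-gap {m} {m'} ℓ i m<m' = begin
  m * ℓ + i + ℓ ≡⟨ xy∙z≈zx∙y (m * ℓ) i ℓ ⟩
  suc m * ℓ + i ≤⟨ +-monoˡ-≤ i (*-monoˡ-≤ ℓ m<m') ⟩
  m' * ℓ + i    ∎
  where open ≤-Reasoning

-- Sorted concatenations

multiplicity : ∀ {n k ℓ} → (Fin ℓ → Vec (Fin n) k) → Fin n → ℕ
multiplicity {ℓ = ℓ} W x = ∑[ i < ℓ ] occ x (W i)

sortedSum≡sorted : ∀ {n k ℓ} (W : Fin ℓ → Vec (Fin n) k) → sortedSum W ≡ sorted (multiplicity W)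
sortedSum≡sorted {n} W =
  trans (concatMap-cong (λ x → cong (λ a → replicate a x) (sumˡ-tabulate (λ i → occ x (W i)))) (allFin n))
        (concatMap-replicate (multiplicity W))

sortedSum-cong : ∀ {n k ℓ} (B D : Fin ℓ → Vec (Fin n) k) →
  (∀ x → multiplicity B x ≡ multiplicity D x) → sortedSum B ≡ sortedSum D
sortedSum-cong {n} B D B≗D = concatMap-cong (λ x → cong (λ a → replicate a x) (begin
  sumˡ (List.tabulate (λ i → occ x (B i))) ≡⟨ sumˡ-tabulate (λ i → occ x (B i)) ⟩
  multiplicity B x                         ≡⟨ B≗D x ⟩
  multiplicity D x                         ≡⟨ sumˡ-tabulate (λ i → occ x (D i)) ⟨
  sumˡ (List.tabulate (λ i → occ x (D i))) ∎)) (allFin n)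
  where open ≡-Reasoning

size-multiplicity : ∀ {n k ℓ} (W : Fin ℓ → Vec (Fin n) k) → size (multiplicity W) ≡ ℓ * k
size-multiplicity {k = k} {ℓ} W =
  trans (∑-comm (λ y i → occ y (W i))) (trans (sum-cong-≗ (size-counts ∘ W)) (∑-const ℓ k))

sortedSum-mono : ∀ {n k ℓ} (B T : Fin ℓ → Vec (Fin n) k) →
  (∀ i → B i ≺ T i) → sortedSum B ≺ˡ sortedSum T
sortedSum-mono B T B≺T =
  subst₂ _≺ˡ_ (sym (sortedSum≡sorted B)) (sym (sortedSum≡sorted T))
    (Equivalence.from (sorted-≺ˡ⇔ (multiplicity B) (multiplicity T))
      (trans (size-multiplicity B) (sym (size-multiplicity T)) , dominated))
  where
  dominated : ∀ x → atMost (multiplicity T) x ≤ atMost (multiplicity B) x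
  dominated x = subst₂ _≤_ (sym (atMost-∑ (counts ∘ T) x)) (sym (atMost-∑ (counts ∘ B) x))
                  (∑-mono-≤ (λ i → ≺⇒atMost-counts-≥ (B≺T i) x))

multiplicity≤ : ∀ {n k ℓ} (D : Fin ℓ → Vec (Fin n) k) → (∀ i → StrictlyIncreasing (D i)) →
  ∀ x → multiplicity D x ≤ ℓ
multiplicity≤ {ℓ = ℓ} D D-SI x =
  ≤-trans (∑-mono-≤ (λ i → occ≤1 (D i) (D-SI i))) (≤-reflexive (trans (∑-const ℓ 1) (*-identityʳ ℓ)))

row<atMost-lookup : ∀ {n k ℓ} (T : Vec (Fin n) k) → StrictlyIncreasing T → (c : Fin n → ℕ) →
  (∀ x → atMost (multiplicity {ℓ = ℓ} (λ _ → T)) x ≤ atMost c x) →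
  ∀ m {i} → i < ℓ → toℕ m * ℓ + i < atMost c (lookup T m)
row<atMost-lookup {ℓ = ℓ} T T-SI c dominated m {i} i<ℓ = begin-strict
  toℕ m * ℓ + i                                       <⟨ row-bound ℓ (n<1+n (toℕ m)) i<ℓ ⟩
  suc (toℕ m) * ℓ                                     ≤⟨ *-monoˡ-≤ ℓ (atMost-counts-lookup T T-SI m) ⟩
  atMost (counts T) (lookup T m) * ℓ                  ≡⟨ *-comm _ ℓ ⟩
  ℓ * atMost (counts T) (lookup T m)                  ≡⟨ ∑-const ℓ _ ⟨
  ∑[ i < ℓ ] atMost (counts T) (lookup T m)           ≡⟨ atMost-∑ {ℓ = ℓ} (λ _ → counts T) (lookup T m) ⟨
  atMost (multiplicity {ℓ = ℓ} (λ _ → T)) (lookup T m) ≤⟨ dominated (lookup T m) ⟩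
  atMost c (lookup T m)                               ∎
  where open ≤-Reasoning

multiplicity-columns : ∀ {n} k ℓ (c : Fin n → ℕ) d → size c ≡ k * ℓ →
  ∀ x → multiplicity {ℓ = ℓ} (λ i → column k ℓ (λ p → nth (sorted c) p d) (toℕ i)) x ≡ c x
multiplicity-columns {n} k ℓ c d size≡ x = begin
  ∑[ i < ℓ ] occ x (column k ℓ f (toℕ i))
    ≡⟨ ∑-occ-column k ℓ f x ⟩
  occ x (fromList (applyUpTo f (k * ℓ)))
    ≡⟨ cong (λ N → occ x (fromList (applyUpTo f N))) (trans (length-sorted c) size≡) ⟨
  occ x (fromList (applyUpTo f (length (sorted c))))
    ≡⟨ cong (occ x ∘ fromList) (applyUpTo-nth (sorted c) d) ⟩
  occ x (fromList (sorted c))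
    ≡⟨ occ-fromList-sorted c x ⟩
  c x ∎
  where
  open ≡-Reasoning
  f : ℕ → Fin n
  f p = nth (sorted c) p d

empty-basis : ∀ {n} (v : Vec (Fin n) 0) → ⟨ [] ⟩ v
empty-basis [] = (λ ()) , []

split-into-bases : ∀ {n k ℓ} (T : Vec (Fin n) k) → StrictlyIncreasing T →
  (D : Fin ℓ → Vec (Fin n) k) → (∀ i → StrictlyIncreasing (D i)) →
  sortedSum D ≺ˡ sortedSum {ℓ = ℓ} (λ _ → T) →
  Σ[ B ∈ (Fin ℓ → Vec (Fin n) k) ] (∀ i → ⟨ T ⟩ (B i)) × sortedSum B ≡ sortedSum D
split-into-bases []         _    D _    _    = D , (λ i → empty-basis (D i)) , refl
split-into-bases {n} {suc k} {ℓ} T@(t ∷ _) T-SI D D-SI D≺ℓT =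
  B , (λ i → B-SI i , B≺T i) , sortedSum-cong B D (multiplicity-columns (suc k) ℓ c t size-c)
  where
  c cT : Fin n → ℕ
  c  = multiplicity D
  cT = multiplicity {ℓ = ℓ} (λ _ → T)

  criterion : size c ≡ size cT × (∀ x → atMost cT x ≤ atMost c x)
  criterion = Equivalence.to (sorted-≺ˡ⇔ c cT)
    (subst₂ _≺ˡ_ (sortedSum≡sorted D) (sortedSum≡sorted {ℓ = ℓ} (λ _ → T)) D≺ℓT)

  size-c : size c ≡ suc k * ℓ
  size-c = trans (proj₁ criterion) (trans (size-multiplicity {ℓ = ℓ} (λ _ → T)) (*-comm ℓ (suc k)))

  -- t is only the out-of-range default: every position read is below size c.
  f : ℕ → Fin n
  f p = nth (sorted c) p t

  B : Fin ℓ → Vec (Fin n) (suc k)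
  B i = column (suc k) ℓ f (toℕ i)

  B-SI : ∀ i → StrictlyIncreasing (B i)
  B-SI i = column-strictlyIncreasing (suc k) ℓ f (toℕ i) λ m<m' m'<k →
    nth-sorted-<-apart c (multiplicity≤ D D-SI) t t (row-gap ℓ (toℕ i) m<m')
      (subst (_ <_) (sym size-c) (row-bound ℓ m'<k (toℕ<n i)))

  B≺T : ∀ i → B i ≺ T
  B≺T i = column-≺ ℓ f (toℕ i) T λ m →
    nth-sorted-≤ c (lookup T m) t (row<atMost-lookup T T-SI c (proj₂ criterion) m (toℕ<n i))

lemma30 : ∀ (n k : ℕ) (T : Vec (Fin n) k) → StrictlyIncreasing T →
    ∀ (ℓ : ℕ) → 1 < ℓ →
    (UniformAssumable ℓ ⟨ T ⟩
      ⇔ (∀ (D : Fin ℓ → Vec (Fin n) k) →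
           (∀ i → StrictlyIncreasing (D i) × ¬ ⟨ T ⟩ (D i)) →
           ¬ (sortedSum D ≺ˡ sortedSum {ℓ = ℓ} (λ _ → T))))
lemma30 n k T T-SI ℓ _ = mk⇔
  (λ assumable D D∉M D≺ℓT →
     let (B , B∈M , B≡D) = split-into-bases T T-SI D (proj₁ ∘ D∉M) D≺ℓT
     in assumable B D B∈M D∉M B≡D)
  (λ no-D≺ℓT B D B∈M D∉M B≡D →
     no-D≺ℓT D D∉M
       (subst (_≺ˡ sortedSum {ℓ = ℓ} (λ _ → T)) B≡D (sortedSum-mono B (λ _ → T) (proj₂ ∘ B∈M))))
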